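{- Let $W=\sum_{n\ge0}W_n\frac{X^n}{n!}\in\mathbb C[[X]]$. Define $G_0=1$ and $G_{n+1}=(WG_n)'$ (derivative with respect to $X$), and $Z_0=\sum_{n\ge0}([X^0]G_n)\frac{s^n}{n!}\in\mathbb C[[s]]$. For $n\ge1$ let $\mathcal A_n$ be the set of maps $f:\{1,\dots,n\}\to\{1,\dots,n\}$ with $f(k)\le k$ for all $k$, and for such $f$ let $e_W(f)=\prod_{k=1}^nW_{\#f^{ -1}(k)}$. Then $$Z_0=1+\sum_{n\ge1}\frac{s^n}{n!}\sum_{f\in\mathcal A_n}e_W(f).$$
   Context: $[X^0]G$ is the constant term of $G$; $\#f^{ -1}(k)$ is the number of preimages of $k$ under $f$. -}

module Defs where

open import Level using (Level)
open import Data.Nat using (ℕ; zero; suc; _∸_)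
open import Data.Nat.Combinatorics using (_C_)
open import Data.Fin using (Fin; toℕ; _≟_) renaming (_≤_ to _≤ᶠ_)
import Data.Fin.Properties as FinP
open import Data.List using (List; []; _∷_; [_]; map; concatMap; filter; foldr; length; upTo; allFin)
open import Data.Vec.Functional using (Vector) renaming (_∷_ to _∷ᵛ_)
open import Relation.Nullary using (Dec)
open import Algebra.Bundles using (CommutativeRing)

allFuns : (m n : ℕ) → List (Fin m → Fin n)
allFuns zero    n = [ (λ ()) ]
allFuns (suc m) n = concatMap (λ f → map (λ i → i ∷ᵛ f) (allFin n)) (allFuns m n)

-- f(k) ≤ k for all k (with {1..n} represented by Fin n, shifted by one).
IsA : (n : ℕ) → (Fin n → Fin n) → Set
IsA n f = ∀ k → f k ≤ᶠ k

IsA? : (n : ℕ) → (f : Fin n → Fin n) → Dec (IsA n f)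
IsA? n f = FinP.all? (λ k → f k FinP.≤? k)

𝒜 : (n : ℕ) → List (Fin n → Fin n)
𝒜 n = filter (IsA? n) (allFuns n n)

preimageCount : {n : ℕ} → (Fin n → Fin n) → Fin n → ℕ
preimageCount {n} f k = length (filter (λ j → f j ≟ k) (allFin n))

module _ {c ℓ : Level} (R : CommutativeRing c ℓ) where
  open CommutativeRing R

  ΣL : {A : Set} → List A → (A → Carrier) → Carrier
  ΣL xs g = foldr (λ x acc → g x + acc) 0# xs

  ΠL : {A : Set} → List A → (A → Carrier) → Carrier
  ΠL xs g = foldr (λ x acc → g x * acc) 1# xs

  natMul : ℕ → Carrier → Carrier
  natMul zero    x = 0#
  natMul (suc n) x = x + natMul n x

  -- A formal power series F = Σ_n F(n) Xⁿ/n! is represented by its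
  -- sequence of "exponential" coefficients F(n) = n!·[Xⁿ]F.
  Series : Set c
  Series = ℕ → Carrier

  oneS : Series
  oneS zero    = 1#
  oneS (suc _) = 0#

  mulS : Series → Series → Series
  mulS F G n = ΣL (upTo (suc n)) (λ k → natMul (n C k) (F k * G (n ∸ k)))

  derivS : Series → Series
  derivS F n = F (suc n)

  const : Series → Carrier
  const F = F 0

  Gseq : Series → ℕ → Series
  Gseq W zero    = oneS
  Gseq W (suc n) = derivS (mulS W (Gseq W n))

  eW : Series → {n : ℕ} → (Fin n → Fin n) → Carrier
  eW W {n} f = ΠL (allFin n) (λ k → W (preimageCount f k))

  Z0coeff : Series → ℕ → Carrier
  Z0coeff W n = const (Gseq W n)

  RHScoeff : Series → ℕ → Carrier
  RHScoeff W zero      = 1#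
  RHScoeff W n@(suc _) = ΣL (𝒜 n) (eW W)

-- Expanding G n = (W (⋯ (W · 1)′ ⋯))′ by the Leibniz rule, the k-th derivative falls on
-- one of the factors present at that moment: the initial factor 1, whose derivatives
-- vanish, or one of the first k copies of W.  Recording the copy hit by the k-th
-- derivative as f k ≤ k, copy j ends up differentiated #f⁻¹(j) times, and its constant
-- term is then W_{#f⁻¹(j)}; so the constant term of G n is the sum of e_W(f) over 𝒜 n.
--
-- Both sides are instances of one quantity (spread): for factors G₀, …, G₍ₙ₋₁₎ and bounds
-- b₀, …, b₍ₘ₋₁₎, the sum over all f : Fin m → Fin n with f k < b_k of ∏ⱼ G_j^{(#f⁻¹(j))}(0).
-- Unfolding the choice of f 0 gives its recursion; the Leibniz rule lets a product factor
-- F · X be split into two factors X, F, which turns G n into a spread over n copies of W.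
module Submission where

open import Defs
open import Level using (Level)
open import Data.Nat using (ℕ)
open import Algebra.Bundles using (CommutativeRing)

import Data.Nat as ℕ
open import Data.Nat using (zero; suc; _∸_; _<_; _<ᵇ_; s≤s; s≤s⁻¹)
open import Data.Nat.Properties using (+-∸-assoc; n<1+n; <ᵇ⇒<; <⇒<ᵇ)
open import Data.Nat.Combinatorics using (_C_; k>n⇒nCk≡0; nCk+nC[k+1]≡[n+1]C[k+1])
open import Data.Bool using (Bool; true; false; if_then_else_; _∧_; T)
open import Data.Bool.Properties using (T-∧)
open import Data.Unit using (tt)
open import Data.Product using (_,_; proj₁; proj₂)
open import Data.Fin using (Fin; toℕ; _≟_)
open import Data.List using (List; []; _∷_; _++_; [_]; map; concatMap; filter; length; upTo; allFin; tabulate)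
open import Data.List.Properties using (foldr-map; foldr-cong; map-tabulate; map-applyUpTo; applyUpTo-∷ʳ)
open import Data.List.Membership.Propositional using (_∈_)
open import Data.List.Membership.Propositional.Properties using (∈-upTo⁻)
open import Data.List.Relation.Unary.Any using (here; there)
import Data.Vec as Vec
open import Data.Vec using (Vec; []; _∷_; lookup; updateAt; replicate)
open import Data.Vec.Properties using (lookup-map; lookup∘updateAt; lookup∘updateAt′; lookup-replicate)
open import Data.Vec.Functional using (tail) renaming (_∷_ to _∷ᵛ_)
open import Function using (_∘_; id; _$_; Equivalence)
open import Relation.Nullary using (does; yes; no)
open import Relation.Nullary.Decidable using (does-≡; map′; T?)
open import Relation.Unary using (Pred; Decidable)
import Relation.Binary.PropositionalEquality as ≡
open ≡ using (_≡_)

length-filter-map : ∀ {a b p} {A : Set a} {B : Set b} {P : Pred B p} (P? : Decidable P) (g : A → B) xs →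
  length (filter P? (map g xs)) ≡ length (filter (P? ∘ g) xs)
length-filter-map P? g []       = ≡.refl
length-filter-map P? g (x ∷ xs) with does (P? (g x))
... | true  = ≡.cong suc (length-filter-map P? g xs)
... | false = length-filter-map P? g xs

#preimage : ∀ {m n} → (Fin m → Fin n) → Fin n → ℕ
#preimage {m} f v = length (filter (λ j → f j ≟ v) (allFin m))

#preimage-tail : ∀ {m n} (i : Fin n) (f : Fin m → Fin n) v →
  length (filter (λ j → (i ∷ᵛ f) j ≟ v) (tabulate Fin.suc)) ≡ #preimage f v
#preimage-tail {m} i f v = ≡.trans
  (≡.cong (length ∘ filter (λ j → (i ∷ᵛ f) j ≟ v)) (≡.sym (map-tabulate id Fin.suc)))
  (length-filter-map (λ j → (i ∷ᵛ f) j ≟ v) Fin.suc (allFin m))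

respects : ∀ {m n} → Vec ℕ m → (Fin m → Fin n) → Bool
respects []       f = true
respects (b ∷ bs) f = (toℕ (f Fin.zero) <ᵇ b) ∧ respects bs (tail f)

respects-sound : ∀ {m n} (bs : Vec ℕ m) (f : Fin m → Fin n) → T (respects bs f) → ∀ k → toℕ (f k) < lookup bs k
respects-sound (b ∷ bs) f t Fin.zero    = <ᵇ⇒< _ b (proj₁ (Equivalence.to T-∧ t))
respects-sound (b ∷ bs) f t (Fin.suc k) = respects-sound bs (tail f) (proj₂ (Equivalence.to T-∧ t)) k

respects-complete : ∀ {m n} (bs : Vec ℕ m) (f : Fin m → Fin n) → (∀ k → toℕ (f k) < lookup bs k) → T (respects bs f)
respects-complete []       f _ = tt
respects-complete (b ∷ bs) f h = Equivalence.from T-∧ (<⇒<ᵇ (h Fin.zero) , respects-complete bs (tail f) (h ∘ Fin.suc))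

oneTo : (n : ℕ) → Vec ℕ n
oneTo zero    = []
oneTo (suc n) = 1 ∷ Vec.map suc (oneTo n)

lookup-oneTo : ∀ {n} (k : Fin n) → lookup (oneTo n) k ≡ suc (toℕ k)
lookup-oneTo Fin.zero            = ≡.refl
lookup-oneTo {suc n} (Fin.suc k) = ≡.trans (lookup-map k suc (oneTo n)) (≡.cong suc (lookup-oneTo k))

does-IsA? : ∀ n (f : Fin n → Fin n) → does (IsA? n f) ≡ respects (oneTo n) f
does-IsA? n f = does-≡ (IsA? n f) (map′ sound complete (T? (respects (oneTo n) f)))
  where
  sound : T (respects (oneTo n) f) → IsA n f
  sound t k = s≤s⁻¹ (≡.subst (toℕ (f k) <_) (lookup-oneTo k) (respects-sound (oneTo n) f t k))
  complete : IsA n f → T (respects (oneTo n) f)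
  complete h = respects-complete (oneTo n) f (λ k → ≡.subst (toℕ (f k) <_) (≡.sym (lookup-oneTo k)) (s≤s (h k)))

module _ {c ℓ : Level} (R : CommutativeRing c ℓ) where
  open CommutativeRing R
  open import Relation.Binary.Reasoning.Setoid setoid
  open import Algebra.Properties.CommutativeSemigroup +-commutativeSemigroup using (interchange; x∙yz≈y∙xz)

  ∑-syntax : {A : Set} → List A → (A → Carrier) → Carrier
  ∑-syntax = ΣL R
  syntax ∑-syntax xs (λ x → g) = ∑[ x ∈ xs ] g

  ∏-syntax : {A : Set} → List A → (A → Carrier) → Carrier
  ∏-syntax = ΠL R
  syntax ∏-syntax xs (λ x → g) = ∏[ x ∈ xs ] g

  ∑-cong-∈ : ∀ {A : Set} (xs : List A) {g h : A → Carrier} →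
    (∀ {x} → x ∈ xs → g x ≈ h x) → ∑[ x ∈ xs ] g x ≈ ∑[ x ∈ xs ] h x
  ∑-cong-∈ []       g≈h = refl
  ∑-cong-∈ (x ∷ xs) g≈h = +-cong (g≈h (here ≡.refl)) (∑-cong-∈ xs (g≈h ∘ there))

  ∑-cong : ∀ {A : Set} (xs : List A) {g h : A → Carrier} → (∀ x → g x ≈ h x) → ∑[ x ∈ xs ] g x ≈ ∑[ x ∈ xs ] h x
  ∑-cong xs g≈h = ∑-cong-∈ xs (λ {x} _ → g≈h x)

  ∑-zero : ∀ {A : Set} (xs : List A) → ∑[ x ∈ xs ] 0# ≈ 0#
  ∑-zero []       = refl
  ∑-zero (x ∷ xs) = trans (+-identityˡ _) (∑-zero xs)

  ∑-distrib-+ : ∀ {A : Set} (xs : List A) (g h : A → Carrier) →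
    ∑[ x ∈ xs ] (g x + h x) ≈ ∑[ x ∈ xs ] g x + ∑[ x ∈ xs ] h x
  ∑-distrib-+ []       g h = sym (+-identityʳ 0#)
  ∑-distrib-+ (x ∷ xs) g h = trans (+-congˡ (∑-distrib-+ xs g h)) (interchange _ _ _ _)

  ∑-++ : ∀ {A : Set} (xs ys : List A) (g : A → Carrier) → ∑[ x ∈ xs ++ ys ] g x ≈ ∑[ x ∈ xs ] g x + ∑[ y ∈ ys ] g y
  ∑-++ []       ys g = sym (+-identityˡ _)
  ∑-++ (x ∷ xs) ys g = trans (+-congˡ (∑-++ xs ys g)) (sym (+-assoc _ _ _))

  ∑-map : ∀ {A B : Set} (φ : A → B) (xs : List A) (g : B → Carrier) → ∑[ y ∈ map φ xs ] g y ≡ ∑[ x ∈ xs ] g (φ x)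
  ∑-map φ xs g = foldr-map _ φ 0# xs

  ∑-concatMap : ∀ {A B : Set} (h : A → List B) (xs : List A) (g : B → Carrier) →
    ∑[ y ∈ concatMap h xs ] g y ≈ ∑[ x ∈ xs ] ∑[ y ∈ h x ] g y
  ∑-concatMap h []       g = refl
  ∑-concatMap h (x ∷ xs) g = trans (∑-++ (h x) (concatMap h xs) g) (+-congˡ (∑-concatMap h xs g))

  ∑-comm : ∀ {A B : Set} (xs : List A) (ys : List B) (g : A → B → Carrier) →
    ∑[ x ∈ xs ] ∑[ y ∈ ys ] g x y ≈ ∑[ y ∈ ys ] ∑[ x ∈ xs ] g x y
  ∑-comm []       ys g = sym (∑-zero ys)
  ∑-comm (x ∷ xs) ys g = trans (+-congˡ (∑-comm xs ys g)) (sym (∑-distrib-+ ys (g x) _))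

  ∑-filter : ∀ {A : Set} {p} {P : Pred A p} (P? : Decidable P) (xs : List A) (g : A → Carrier) →
    ∑[ x ∈ filter P? xs ] g x ≈ ∑[ x ∈ xs ] (if does (P? x) then g x else 0#)
  ∑-filter P? []       g = refl
  ∑-filter P? (x ∷ xs) g with does (P? x)
  ... | true  = +-congˡ (∑-filter P? xs g)
  ... | false = trans (∑-filter P? xs g) (sym (+-identityˡ _))

  ∑-allFin-suc : ∀ {n} (g : Fin (suc n) → Carrier) → ∑[ i ∈ allFin (suc n) ] g i ≡ g Fin.zero + ∑[ i ∈ allFin n ] g (Fin.suc i)
  ∑-allFin-suc {n} g = ≡.cong (g Fin.zero +_)
    (≡.trans (≡.cong (λ is → ∑[ i ∈ is ] g i) (≡.sym (map-tabulate id Fin.suc))) (∑-map Fin.suc (allFin n) g))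

  ∑-upTo-suc : ∀ n (g : ℕ → Carrier) → ∑[ k ∈ upTo (suc n) ] g k ≡ g 0 + ∑[ k ∈ upTo n ] g (suc k)
  ∑-upTo-suc n g = ≡.cong (g 0 +_)
    (≡.trans (≡.cong (λ ks → ∑[ k ∈ ks ] g k) (≡.sym (map-applyUpTo id suc n))) (∑-map suc (upTo n) g))

  ∑-upTo-∷ʳ : ∀ n (g : ℕ → Carrier) → ∑[ k ∈ upTo (suc n) ] g k ≈ ∑[ k ∈ upTo n ] g k + g n
  ∑-upTo-∷ʳ n g = begin
      ∑[ k ∈ upTo (suc n) ] g k       ≡⟨ ≡.cong (λ ks → ∑[ k ∈ ks ] g k) (≡.sym (applyUpTo-∷ʳ id n)) ⟩
      ∑[ k ∈ upTo n ++ [ n ] ] g k    ≈⟨ ∑-++ (upTo n) [ n ] g ⟩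
      ∑[ k ∈ upTo n ] g k + (g n + 0#) ≈⟨ +-congˡ (+-identityʳ (g n)) ⟩
      ∑[ k ∈ upTo n ] g k + g n       ∎

  ∏-cong : ∀ {A : Set} (xs : List A) {g h : A → Carrier} → (∀ x → g x ≡ h x) → ∏[ x ∈ xs ] g x ≡ ∏[ x ∈ xs ] h x
  ∏-cong xs g≡h = foldr-cong (λ x y → ≡.cong (_* y) (g≡h x)) ≡.refl xs

  D : Series R → Series R
  D = derivS R

  infixl 7 _⋆_
  _⋆_ : Series R → Series R → Series R
  _⋆_ = mulS R

  natMul-+ : ∀ a b x → natMul R (a ℕ.+ b) x ≈ natMul R a x + natMul R b x
  natMul-+ zero    b x = sym (+-identityˡ _)
  natMul-+ (suc a) b x = trans (+-congˡ (natMul-+ a b x)) (sym (+-assoc _ _ _))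

  D-⋆ : ∀ F G m → D (F ⋆ G) m ≈ (D F ⋆ G) m + (F ⋆ D G) m
  D-⋆ F G m = begin
      D (F ⋆ G) m                                          ≡⟨ ∑-upTo-suc (suc m) t ⟩
      t 0 + ∑[ j ∈ upTo (suc m) ] t (suc j)                ≈⟨ +-congˡ (∑-cong (upTo (suc m)) pascal) ⟩
      t 0 + ∑[ j ∈ upTo (suc m) ] (a j + b j)              ≈⟨ +-congˡ (∑-distrib-+ (upTo (suc m)) a b) ⟩
      t 0 + ((D F ⋆ G) m + ∑[ j ∈ upTo (suc m) ] b j)      ≈⟨ x∙yz≈y∙xz _ _ _ ⟩
      (D F ⋆ G) m + (t 0 + ∑[ j ∈ upTo (suc m) ] b j)      ≈⟨ +-congˡ (+-congˡ b-shift) ⟩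
      (D F ⋆ G) m + (t 0 + ∑[ j ∈ upTo m ] u (suc j))      ≡⟨ ≡.cong ((D F ⋆ G) m +_) (≡.sym (∑-upTo-suc m u)) ⟩
      (D F ⋆ G) m + (F ⋆ D G) m                            ∎
    where
    t a b u : ℕ → Carrier
    t k = natMul R (suc m C k) (F k * G (suc m ∸ k))
    a j = natMul R (m C j) (F (suc j) * G (m ∸ j))
    b j = natMul R (m C suc j) (F (suc j) * G (m ∸ j))
    u k = natMul R (m C k) (F k * G (suc (m ∸ k)))

    pascal : ∀ j → t (suc j) ≈ a j + b j
    pascal j = trans (reflexive (≡.cong (λ n → natMul R n (F (suc j) * G (m ∸ j)))
                                        (≡.sym (nCk+nC[k+1]≡[n+1]C[k+1] m j))))
                     (natMul-+ (m C j) (m C suc j) (F (suc j) * G (m ∸ j)))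

    b-shift : ∑[ j ∈ upTo (suc m) ] b j ≈ ∑[ j ∈ upTo m ] u (suc j)
    b-shift = begin
        ∑[ j ∈ upTo (suc m) ] b j   ≈⟨ ∑-upTo-∷ʳ m b ⟩
        ∑[ j ∈ upTo m ] b j + b m   ≡⟨ ≡.cong (λ n → ∑[ j ∈ upTo m ] b j + natMul R n (F (suc m) * G (m ∸ m)))
                                          (k>n⇒nCk≡0 (n<1+n m)) ⟩
        ∑[ j ∈ upTo m ] b j + 0#    ≈⟨ +-identityʳ _ ⟩
        ∑[ j ∈ upTo m ] b j         ≈⟨ ∑-cong-∈ (upTo m) (λ {j} j<m → reflexive (≡.cong (λ r → natMul R (m C suc j) (F (suc j) * G r))
                                                                                (+-∸-assoc 1 (∈-upTo⁻ j<m)))) ⟩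
        ∑[ j ∈ upTo m ] u (suc j)   ∎

  ∂ : ∀ {n} → Fin n → Vec (Series R) n → Vec (Series R) n
  ∂ i Gs = updateAt Gs i D

  -- The sum of k (∂ i Gs) over i < j, by recursion: ΣL only ranges over lists in Set, while vectors
  -- of series live in Set c.
  ∂-sum : ∀ {n} → ℕ → Vec (Series R) n → (Vec (Series R) n → Carrier) → Carrier
  ∂-sum zero    Gs       k = 0#
  ∂-sum (suc j) []       k = 0#
  ∂-sum (suc j) (G ∷ Gs) k = k (D G ∷ Gs) + ∂-sum j Gs (k ∘ (G ∷_))

  ∂-sum-cong : ∀ {n} j (Gs : Vec (Series R) n) {k k′ : Vec (Series R) n → Carrier} →
    (∀ Hs → k Hs ≈ k′ Hs) → ∂-sum j Gs k ≈ ∂-sum j Gs k′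
  ∂-sum-cong zero    Gs       k≈k′ = refl
  ∂-sum-cong (suc j) []       k≈k′ = refl
  ∂-sum-cong (suc j) (G ∷ Gs) k≈k′ = +-cong (k≈k′ _) (∂-sum-cong j Gs (k≈k′ ∘ (G ∷_)))

  ∂-sum-distrib-+ : ∀ {n} j (Gs : Vec (Series R) n) (k k′ : Vec (Series R) n → Carrier) →
    ∂-sum j Gs (λ Hs → k Hs + k′ Hs) ≈ ∂-sum j Gs k + ∂-sum j Gs k′
  ∂-sum-distrib-+ zero    Gs       k k′ = sym (+-identityʳ 0#)
  ∂-sum-distrib-+ (suc j) []       k k′ = sym (+-identityʳ 0#)
  ∂-sum-distrib-+ (suc j) (G ∷ Gs) k k′ = trans (+-congˡ (∂-sum-distrib-+ j Gs _ _)) (interchange _ _ _ _)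

  ∂-sum-zero : ∀ {n} j (Gs : Vec (Series R) n) {k : Vec (Series R) n → Carrier} →
    (∀ Hs → k Hs ≈ 0#) → ∂-sum j Gs k ≈ 0#
  ∂-sum-zero zero    Gs       k≈0 = refl
  ∂-sum-zero (suc j) []       k≈0 = refl
  ∂-sum-zero (suc j) (G ∷ Gs) k≈0 = trans (+-cong (k≈0 _) (∂-sum-zero j Gs (k≈0 ∘ (G ∷_)))) (+-identityʳ 0#)

  ∑-allFin-∂ : ∀ {n} j (Gs : Vec (Series R) n) (k : Vec (Series R) n → Carrier) →
    ∑[ i ∈ allFin n ] (if toℕ i <ᵇ j then k (∂ i Gs) else 0#) ≈ ∂-sum j Gs k
  ∑-allFin-∂ {n} zero Gs k = ∑-zero (allFin n)
  ∑-allFin-∂ (suc j) []       k = refl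
  ∑-allFin-∂ (suc j) (G ∷ Gs) k =
    trans (reflexive (∑-allFin-suc (λ i → if toℕ i <ᵇ suc j then k (∂ i (G ∷ Gs)) else 0#)))
          (+-congˡ (∑-allFin-∂ j Gs (k ∘ (G ∷_))))

  constProduct : ∀ {n} → Vec (Series R) n → Carrier
  constProduct []       = 1#
  constProduct (G ∷ Gs) = G 0 * constProduct Gs

  spread : ∀ {m n} → Vec (Series R) n → Vec ℕ m → Carrier
  spread Gs []       = constProduct Gs
  spread Gs (b ∷ bs) = ∂-sum b Gs (λ Hs → spread Hs bs)

  spread-additive-head : ∀ {m n} (bs : Vec ℕ m) {A B B′ : Series R} (Fs : Vec (Series R) n) →
    (∀ r → A r ≈ B r + B′ r) → spread (A ∷ Fs) bs ≈ spread (B ∷ Fs) bs + spread (B′ ∷ Fs) bs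
  spread-additive-head []           Fs A≈B+B′ = trans (*-congʳ (A≈B+B′ 0)) (distribʳ _ _ _)
  spread-additive-head (zero  ∷ bs) Fs A≈B+B′ = sym (+-identityʳ 0#)
  spread-additive-head (suc j ∷ bs) Fs A≈B+B′ = trans
    (+-cong (spread-additive-head bs Fs (A≈B+B′ ∘ suc))
            (trans (∂-sum-cong j Fs (λ Hs → spread-additive-head bs Hs A≈B+B′)) (∂-sum-distrib-+ j Fs _ _)))
    (interchange _ _ _ _)

  spread-zero-head : ∀ {m n} (bs : Vec ℕ m) {A : Series R} (Fs : Vec (Series R) n) →
    (∀ r → A r ≈ 0#) → spread (A ∷ Fs) bs ≈ 0#
  spread-zero-head []           Fs A≈0 = trans (*-congʳ (A≈0 0)) (zeroˡ _)
  spread-zero-head (zero  ∷ bs) Fs A≈0 = refl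
  spread-zero-head (suc j ∷ bs) Fs A≈0 = trans
    (+-cong (spread-zero-head bs Fs (A≈0 ∘ suc)) (∂-sum-zero j Fs (λ Hs → spread-zero-head bs Hs A≈0)))
    (+-identityʳ 0#)

  spread-⋆-head : ∀ {m n} (bs : Vec ℕ m) (F X : Series R) (Fs : Vec (Series R) n) →
    spread (F ⋆ X ∷ Fs) (Vec.map suc bs) ≈ spread (X ∷ F ∷ Fs) (Vec.map suc (Vec.map suc bs))
  spread-⋆-head [] F X Fs = begin
      ((F 0 * X 0 + 0#) + 0#) * constProduct Fs  ≈⟨ *-congʳ (trans (+-identityʳ _) (trans (+-identityʳ _) (*-comm _ _))) ⟩
      X 0 * F 0 * constProduct Fs                ≈⟨ *-assoc _ _ _ ⟩
      X 0 * (F 0 * constProduct Fs)              ∎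
  spread-⋆-head (j ∷ bs) F X Fs = begin
      spread (D (F ⋆ X) ∷ Fs) bs′ + ∂-sum j Fs (λ Hs → spread (F ⋆ X ∷ Hs) bs′)
    ≈⟨ +-cong (spread-additive-head bs′ Fs (D-⋆ F X)) (∂-sum-cong j Fs (λ Hs → spread-⋆-head bs F X Hs)) ⟩
      (spread (D F ⋆ X ∷ Fs) bs′ + spread (F ⋆ D X ∷ Fs) bs′) + ∂-sum j Fs (λ Hs → spread (X ∷ F ∷ Hs) bs″)
    ≈⟨ +-congʳ (+-cong (spread-⋆-head bs (D F) X Fs) (spread-⋆-head bs F (D X) Fs)) ⟩
      (spread (X ∷ D F ∷ Fs) bs″ + spread (D X ∷ F ∷ Fs) bs″) + ∂-sum j Fs (λ Hs → spread (X ∷ F ∷ Hs) bs″)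
    ≈⟨ trans (+-congʳ (+-comm _ _)) (+-assoc _ _ _) ⟩
      spread (D X ∷ F ∷ Fs) bs″ + (spread (X ∷ D F ∷ Fs) bs″ + ∂-sum j Fs (λ Hs → spread (X ∷ F ∷ Hs) bs″))
    ∎
    where
    bs′ = Vec.map suc bs
    bs″ = Vec.map suc bs′

  spread-oneS-head : ∀ {m n} (bs : Vec ℕ m) (Fs : Vec (Series R) n) → spread (oneS R ∷ Fs) (Vec.map suc bs) ≈ spread Fs bs
  spread-oneS-head []       Fs = *-identityˡ _
  spread-oneS-head (j ∷ bs) Fs = trans
    (+-cong (spread-zero-head (Vec.map suc bs) Fs (λ _ → refl)) (∂-sum-cong j Fs (spread-oneS-head bs)))
    (+-identityˡ _)

  chain : ∀ {n} → Vec (Series R) n → Series R → Series R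
  chain []       X = X
  chain (F ∷ Fs) X = chain Fs (D (F ⋆ X))

  -- X sits at position 0, so the k-th derivative may hit X or one of the first k + 1 factors of Fs.
  chain≈spread : ∀ {n} (Fs : Vec (Series R) n) X → chain Fs X 0 ≈ spread (X ∷ Fs) (Vec.map suc (oneTo n))
  chain≈spread []                X = sym (*-identityʳ (X 0))
  chain≈spread {suc n} (F ∷ Fs) X = begin
      chain Fs (D (F ⋆ X)) 0                               ≈⟨ chain≈spread Fs (D (F ⋆ X)) ⟩
      spread (D (F ⋆ X) ∷ Fs) (Vec.map suc (oneTo n))      ≈⟨ +-identityʳ _ ⟨
      spread (F ⋆ X ∷ Fs) (oneTo (suc n))                  ≈⟨ spread-⋆-head (0 ∷ oneTo n) F X Fs ⟩
      spread (X ∷ F ∷ Fs) (Vec.map suc (oneTo (suc n)))    ∎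

  weight : ∀ {m n} → Vec (Series R) n → (Fin m → Fin n) → Carrier
  weight {n = n} Gs f = ∏[ v ∈ allFin n ] lookup Gs v (#preimage f v)

  weight-∷ : ∀ {m n} (Gs : Vec (Series R) n) i (f : Fin m → Fin n) → weight Gs (i ∷ᵛ f) ≡ weight (∂ i Gs) f
  weight-∷ {n = n} Gs i f = ∏-cong (allFin n) factor
    where
    factor : ∀ v → lookup Gs v (#preimage (i ∷ᵛ f) v) ≡ lookup (∂ i Gs) v (#preimage f v)
    factor v with i ≟ v
    ... | yes ≡.refl = ≡.trans (≡.cong (lookup Gs i ∘ suc) (#preimage-tail i f i))
                               (≡.cong (_$ #preimage f i) (≡.sym (lookup∘updateAt i Gs)))
    ... | no  i≢v    = ≡.trans (≡.cong (lookup Gs v) (#preimage-tail i f v))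
                               (≡.cong (_$ #preimage f v) (≡.sym (lookup∘updateAt′ v i (i≢v ∘ ≡.sym) Gs)))

  weight-empty : ∀ {n} (Gs : Vec (Series R) n) (f : Fin 0 → Fin n) → weight Gs f ≡ constProduct Gs
  weight-empty []       f = ≡.refl
  weight-empty {suc n} (G ∷ Gs) f = ≡.cong (G 0 *_) (≡.trans
    (≡.cong (λ vs → ∏[ v ∈ vs ] lookup (G ∷ Gs) v 0) (≡.sym (map-tabulate id Fin.suc)))
    (≡.trans (foldr-map _ Fin.suc 1# (allFin n)) (weight-empty Gs (λ ()))))

  ∑-allFuns-suc : ∀ {m n} (g : (Fin (suc m) → Fin n) → Carrier) →
    ∑[ f ∈ allFuns (suc m) n ] g f ≈ ∑[ i ∈ allFin n ] ∑[ f ∈ allFuns m n ] g (i ∷ᵛ f)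
  ∑-allFuns-suc {m} {n} g = begin
      ∑[ f ∈ allFuns (suc m) n ] g f                                ≈⟨ ∑-concatMap (λ f → map (_∷ᵛ f) (allFin n)) (allFuns m n) g ⟩
      ∑[ f ∈ allFuns m n ] ∑[ h ∈ map (_∷ᵛ f) (allFin n) ] g h      ≈⟨ ∑-cong (allFuns m n) (λ f → reflexive (∑-map (_∷ᵛ f) (allFin n) g)) ⟩
      ∑[ f ∈ allFuns m n ] ∑[ i ∈ allFin n ] g (i ∷ᵛ f)             ≈⟨ ∑-comm (allFuns m n) (allFin n) (λ f i → g (i ∷ᵛ f)) ⟩
      ∑[ i ∈ allFin n ] ∑[ f ∈ allFuns m n ] g (i ∷ᵛ f)             ∎

  ∑-respecting≈spread : ∀ {m n} (bs : Vec ℕ m) (Gs : Vec (Series R) n) →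
    ∑[ f ∈ allFuns m n ] (if respects bs f then weight Gs f else 0#) ≈ spread Gs bs
  ∑-respecting≈spread []       Gs = trans (+-identityʳ _) (reflexive (weight-empty Gs (λ ())))
  ∑-respecting≈spread {suc m} {n} (b ∷ bs) Gs = begin
      ∑[ f ∈ allFuns (suc m) n ] (if respects (b ∷ bs) f then weight Gs f else 0#)
    ≈⟨ ∑-allFuns-suc (λ f → if respects (b ∷ bs) f then weight Gs f else 0#) ⟩
      ∑[ i ∈ allFin n ] ∑[ f ∈ allFuns m n ] (if (toℕ i <ᵇ b) ∧ respects bs f then weight Gs (i ∷ᵛ f) else 0#)
    ≈⟨ ∑-cong (allFin n) first-value ⟩
      ∑[ i ∈ allFin n ] (if toℕ i <ᵇ b then spread (∂ i Gs) bs else 0#)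
    ≈⟨ ∑-allFin-∂ b Gs (λ Hs → spread Hs bs) ⟩
      spread Gs (b ∷ bs)
    ∎
    where
    first-value : ∀ i → ∑[ f ∈ allFuns m n ] (if (toℕ i <ᵇ b) ∧ respects bs f then weight Gs (i ∷ᵛ f) else 0#)
                        ≈ (if toℕ i <ᵇ b then spread (∂ i Gs) bs else 0#)
    first-value i with toℕ i <ᵇ b
    ... | false = ∑-zero (allFuns m n)
    ... | true  = trans (∑-cong (allFuns m n) (λ f → reflexive (≡.cong (if respects bs f then_else 0#) (weight-∷ Gs i f))))
                        (∑-respecting≈spread bs (∂ i Gs))

  module _ (W : Series R) where

    chain-replicate-suc : ∀ n X → chain (replicate (suc n) W) X ≡ D (W ⋆ chain (replicate n W) X)
    chain-replicate-suc zero    X = ≡.refl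
    chain-replicate-suc (suc n) X = chain-replicate-suc n (D (W ⋆ X))

    Gseq≡chain : ∀ n → Gseq R W n ≡ chain (replicate n W) (oneS R)
    Gseq≡chain zero    = ≡.refl
    Gseq≡chain (suc n) = ≡.trans (≡.cong (D ∘ (W ⋆_)) (Gseq≡chain n)) (≡.sym (chain-replicate-suc n (oneS R)))

    Z0coeff≈spread : ∀ n → Z0coeff R W n ≈ spread (replicate n W) (oneTo n)
    Z0coeff≈spread n = begin
      Gseq R W n 0                                               ≡⟨ ≡.cong (λ G → G 0) (Gseq≡chain n) ⟩
      chain (replicate n W) (oneS R) 0                           ≈⟨ chain≈spread (replicate n W) (oneS R) ⟩
      spread (oneS R ∷ replicate n W) (Vec.map suc (oneTo n))    ≈⟨ spread-oneS-head (oneTo n) (replicate n W) ⟩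
      spread (replicate n W) (oneTo n)                           ∎

    eW≡weight : ∀ {n} (f : Fin n → Fin n) → eW R W f ≡ weight (replicate n W) f
    eW≡weight {n} f = ∏-cong (allFin n) (λ v → ≡.cong (_$ #preimage f v) (≡.sym (lookup-replicate v W)))

    Z0coeff≈∑𝒜 : ∀ n → Z0coeff R W n ≈ ∑[ f ∈ 𝒜 n ] eW R W f
    Z0coeff≈∑𝒜 n = begin
        Z0coeff R W n
      ≈⟨ Z0coeff≈spread n ⟩
        spread (replicate n W) (oneTo n)
      ≈⟨ ∑-respecting≈spread (oneTo n) (replicate n W) ⟨
        ∑[ f ∈ allFuns n n ] (if respects (oneTo n) f then weight (replicate n W) f else 0#)
      ≈⟨ ∑-cong (allFuns n n) (λ f → reflexive (≡.cong₂ (if_then_else 0#) (does-IsA? n f) (eW≡weight f))) ⟨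
        ∑[ f ∈ allFuns n n ] (if does (IsA? n f) then eW R W f else 0#)
      ≈⟨ ∑-filter (IsA? n) (allFuns n n) (eW R W) ⟨
        ∑[ f ∈ 𝒜 n ] eW R W f
      ∎

proposition11p5 : {c ℓ : Level} (R : CommutativeRing c ℓ) (W : Series R) →
    ∀ (n : ℕ) → CommutativeRing._≈_ R (Z0coeff R W n) (RHScoeff R W n)
proposition11p5 R W zero      = CommutativeRing.refl R
proposition11p5 R W n@(suc _) = Z0coeff≈∑𝒜 R W n
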